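{- Let $n\ge2$ and let $A[1..n]$ contain a uniformly random permutation of $\{1,\dots,n\}$. Run the partitioning step (described in the context) on $A[1..n]$, let $Q=\max\{A[1],A[n]\}$ and let $\delta\in\{0,1\}$ be the indicator that initially $A[Q]>Q$. Let $\mathcal K$ be the set of values the pointer $k$ has when the comparison $A[k]<p$ is evaluated, and $\mathcal G$ the set of values the pointer $g$ has when the comparison $A[g]>q$ is evaluated. Then \[ \mathcal K=\{2,3,\dots,Q-1+\delta\},\quad|\mathcal K|=Q-2+\delta,\qquad \mathcal G=\{n-1,n-2,\dots,Q\},\quad|\mathcal G|=n-Q. \]
   Context: Partitioning step on $A[1..n]$: $p\gets\min(A[1],A[n])$, $q\gets\max(A[1],A[n])$; $\ell\gets2$, $g\gets n-1$, $k\gets2$. While $k\le g$: (i) if $A[k]<p$: swap $A[k],A[\ell]$, $\ell\gets\ell+1$; (ii) else if $A[k]\ge q$: while ($A[g]>q$ and $k<g$) do $g\gets g-1$ (the comparison $A[g]>q$ being evaluated at every test of this condition); then if $A[g]\ge p$ swap $A[k],A[g]$, else {swap $A[k],A[g]$; swap $A[k],A[\ell]$; $\ell\gets\ell+1$}; then $g\gets g-1$; (iii) $k\gets k+1$. Sets $\{a,\dots,b\}$ with $a>b$ (resp. decreasing lists with $a<b$) are empty. -}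

module Defs where

open import Data.Nat using (ℕ; zero; suc; _+_; _∸_; _<_; _<?_; _<ᵇ_; _≤ᵇ_; _≡ᵇ_; _⊓_; _⊔_)
open import Data.Bool using (Bool; true; false; if_then_else_; _∧_)
open import Data.Fin using (Fin; toℕ; fromℕ<)
open import Data.Fin.Permutation using (Permutation′; _⟨$⟩ʳ_)
open import Data.List using (List; []; _∷_)
open import Data.Product using (_×_; _,_)
open import Relation.Nullary using (yes; no)

-- Arrays are 1-indexed functions ℕ → ℕ (entries outside 1..n are irrelevant).
Array : Set
Array = ℕ → ℕ

arrayOf : (n : ℕ) → Permutation′ n → Array
arrayOf n σ zero = 0
arrayOf n σ (suc j) with j <? n
... | yes j<n = suc (toℕ (σ ⟨$⟩ʳ fromℕ< j<n))
... | no _ = 0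

swap : Array → ℕ → ℕ → Array
swap A i j x = if x ≡ᵇ i then A j else (if x ≡ᵇ j then A i else A x)

-- Inner loop: while (A[g] > q and k < g) do g ← g-1.
-- Every test of the condition evaluates A[g] > q, so the current g is recorded
-- at every test.  Returns the final g and the extended record of g-values.
-- (fuel: the loop runs at most n times, fuel n suffices.)
innerLoop : ℕ → ℕ → Array → ℕ → ℕ → List ℕ → ℕ × List ℕ
innerLoop zero q A k g gs = g , gs
innerLoop (suc f) q A k g gs =
  if (q <ᵇ A g) ∧ (k <ᵇ g)
  then innerLoop f q A k (g ∸ 1) (g ∷ gs)
  else (g , g ∷ gs)

record State : Set where
  constructor st
  field
    arr : Array
    ℓ g k : ℕ
    ks gs : List ℕ   -- recorded k-values (at tests A[k]<p) and g-values (at tests A[g]>q)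

-- Outer loop: while k ≤ g do (i)/(ii)/(iii).  Fuel bounds the number of
-- iterations (each iteration increases k, and k ≤ g ≤ n-1, so fuel n suffices).
outerLoop : ℕ → ℕ → ℕ → ℕ → State → State
outerLoop zero fuelIn p q s = s
outerLoop (suc f) fuelIn p q (st A ℓ g k ks gs) =
  if k ≤ᵇ g
  then outerLoop f fuelIn p q (step (A k <ᵇ p))
  else st A ℓ g k ks gs
  where
  ks' = k ∷ ks
  caseII : State
  caseII with innerLoop fuelIn q A k g gs
  ... | (g' , gs') =
    if p ≤ᵇ A g'
    then st (swap A k g') ℓ (g' ∸ 1) (suc k) ks' gs'
    else st (swap (swap A k g') k ℓ) (suc ℓ) (g' ∸ 1) (suc k) ks' gs'
  step : Bool → State
  step true  = st (swap A k ℓ) (suc ℓ) g (suc k) ks' gs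
  step false = if q ≤ᵇ A k then caseII else st A ℓ g (suc k) ks' gs

partitionRun : (n : ℕ) → Array → State
partitionRun n A =
  outerLoop n n (A 1 ⊓ A n) (A 1 ⊔ A n) (st A 2 (n ∸ 1) 2 [] [])

-- 𝒦 and 𝒢 as lists of recorded pointer values (as sets: via membership).
Kvals : (n : ℕ) → Array → List ℕ
Kvals n A = State.ks (partitionRun n A)

Gvals : (n : ℕ) → Array → List ℕ
Gvals n A = State.gs (partitionRun n A)

delta : Array → ℕ → ℕ
delta A Q = if Q <ᵇ A Q then 1 else 0

-- Call an entry large if it exceeds q. As A holds a permutation of 1..n, exactly n − q
-- entries are large, none of them at the ends 1 and n. While the pointers have not
-- crossed, positions k..g are untouched and hold exactly g + 1 − q large entries: k moves
-- past small entries, and a large entry met by k is exchanged with the first small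
-- entry g finds, every position g skips holding a large entry. So g stops at q − 1,
-- having tested exactly the positions q..n − 1, and k stops at q, or at q + 1 when k
-- itself met the large entry A[q].
module Submission where

open import Defs
open import Data.Bool using (true; false; if_then_else_)
import Data.Fin as Fin
open Fin using (Fin; toℕ; fromℕ<)
open import Data.Fin.Properties using (toℕ<n; toℕ-injective; toℕ-fromℕ<; fromℕ<-toℕ)
open import Data.Fin.Permutation using (Permutation′; _⟨$⟩ʳ_; _⟨$⟩ˡ_; inverseˡ)
open import Data.List using (List; []; _∷_; length; deduplicate; applyUpTo; applyDownFrom)
open import Data.List.Membership.Propositional using (_∈_)
open import Data.List.Membership.Propositional.Properties
  using (∈-applyUpTo⁺; ∈-applyUpTo⁻; ∈-applyDownFrom⁺; ∈-applyDownFrom⁻)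
open import Data.List.Properties using (filter-all; length-applyUpTo; length-applyDownFrom)
open import Data.List.Relation.Unary.AllPairs using ([]; _∷_)
open import Data.List.Relation.Unary.Unique.Propositional using (Unique)
open import Data.List.Relation.Unary.Unique.Propositional.Properties using (applyUpTo⁺₁; applyDownFrom⁺₁)
open import Data.Nat
open import Data.Nat.Properties
open import Data.Product using (_×_; _,_; ∃; proj₁; proj₂)
open import Data.Sum using (_⊎_; inj₁; inj₂)
open import Function using (_∘_)
open import Function.Bundles using (_⇔_; mk⇔; Equivalence)
open import Relation.Binary using (DecidableEquality)
open import Relation.Binary.PropositionalEquality
open import Relation.Nullary using (Dec; yes; no; ¬_; ¬?; does; contradiction)
open import Relation.Nullary.Reflects using (Reflects; ofʸ; ofⁿ; fromEquivalence)
open import Algebra.Properties.CommutativeMonoid.Sum +-0-commutativeMonoid using (sum; sum-permute)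
open import Algebra.Properties.CommutativeSemigroup +-commutativeSemigroup using (xy∙z≈xz∙y)
open import Data.Nat.Tactic.RingSolver using (solve-∀)

deduplicate-Unique : ∀ {A : Set} (_≟ᴬ_ : DecidableEquality A) {xs : List A} →
                     Unique xs → deduplicate _≟ᴬ_ xs ≡ xs
deduplicate-Unique _≟ᴬ_ [] = refl
deduplicate-Unique _≟ᴬ_ {x ∷ xs} (x∉xs ∷ !xs) rewrite deduplicate-Unique _≟ᴬ_ !xs =
  cong (x ∷_) (filter-all (¬? ∘ (x ≟ᴬ_)) x∉xs)

applyUpTo-cong : ∀ {A : Set} {f g : ℕ → A} → (∀ i → f i ≡ g i) → ∀ m → applyUpTo f m ≡ applyUpTo g m
applyUpTo-cong f≗g zero    = refl
applyUpTo-cong f≗g (suc m) = cong₂ _∷_ (f≗g 0) (applyUpTo-cong (f≗g ∘ suc) m)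

applyUpTo-+-suc : ∀ a m → applyUpTo (a +_) (suc m) ≡ a ∷ applyUpTo (suc a +_) m
applyUpTo-+-suc a m = cong₂ _∷_ (+-identityʳ a) (applyUpTo-cong (+-suc a) m)

applyDownFrom-+-∸-suc : ∀ {a k} → a ≤ k → applyDownFrom (a +_) (suc k ∸ a) ≡ k ∷ applyDownFrom (a +_) (k ∸ a)
applyDownFrom-+-∸-suc {a} {k} a≤k rewrite +-∸-assoc 1 a≤k = cong (_∷ applyDownFrom (a +_) (k ∸ a)) (m+[n∸m]≡n a≤k)

offset-interval : ∀ {a b m x} → a + m ≡ suc b → (∃ λ i → i < m × x ≡ a + i) ⇔ (a ≤ x × x ≤ b)
offset-interval {a} {b} {m} {x} a+m≡1+b = mk⇔ to from
  where
  to : (∃ λ i → i < m × x ≡ a + i) → a ≤ x × x ≤ b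
  to (i , i<m , refl) = m≤m+n a i , ≤-pred (subst (a + i <_) a+m≡1+b (+-monoʳ-< a i<m))
  from : a ≤ x × x ≤ b → ∃ λ i → i < m × x ≡ a + i
  from (a≤x , x≤b) = x ∸ a , x∸a<m , sym (m+[n∸m]≡n a≤x)
    where
    x∸a<m : x ∸ a < m
    x∸a<m = subst (x ∸ a <_) (m+n∸m≡n a m)
              (∸-monoˡ-< (subst (x <_) (sym a+m≡1+b) (s≤s x≤b)) a≤x)

∈-applyUpTo-+ : ∀ {a b m x} → a + m ≡ suc b → x ∈ applyUpTo (a +_) m ⇔ (a ≤ x × x ≤ b)
∈-applyUpTo-+ {a} {b} {m} {x} e = mk⇔ (to ∘ ∈-applyUpTo⁻ (a +_)) (member ∘ from)
  where
  open Equivalence (offset-interval {a} {b} {m} {x} e)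
  member : (∃ λ i → i < m × x ≡ a + i) → x ∈ applyUpTo (a +_) m
  member (i , i<m , refl) = ∈-applyUpTo⁺ (a +_) i<m

∈-applyDownFrom-+ : ∀ {a b m x} → a + m ≡ suc b → x ∈ applyDownFrom (a +_) m ⇔ (a ≤ x × x ≤ b)
∈-applyDownFrom-+ {a} {b} {m} {x} e = mk⇔ (to ∘ ∈-applyDownFrom⁻ (a +_)) (member ∘ from)
  where
  open Equivalence (offset-interval {a} {b} {m} {x} e)
  member : (∃ λ i → i < m × x ≡ a + i) → x ∈ applyDownFrom (a +_) m
  member (i , i<m , refl) = ∈-applyDownFrom⁺ (a +_) i<m

deduplicate-applyUpTo-+ : ∀ a m → deduplicate _≟_ (applyUpTo (a +_) m) ≡ applyUpTo (a +_) m
deduplicate-applyUpTo-+ a m =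
  deduplicate-Unique _≟_ (applyUpTo⁺₁ (a +_) m (λ i<j _ → <⇒≢ (+-monoʳ-< a i<j)))

deduplicate-applyDownFrom-+ : ∀ a m → deduplicate _≟_ (applyDownFrom (a +_) m) ≡ applyDownFrom (a +_) m
deduplicate-applyDownFrom-+ a m =
  deduplicate-Unique _≟_ (applyDownFrom⁺₁ (a +_) m (λ j<i _ → >⇒≢ (+-monoʳ-< a j<i)))

indicator : {P : Set} → Dec P → ℕ
indicator P? = if does P? then 1 else 0

count : {P : ℕ → Set} → (∀ x → Dec (P x)) → ℕ → ℕ
count P? zero    = 0
count P? (suc m) = indicator (P? 0) + count (P? ∘ suc) m

count-suc : ∀ {P : ℕ → Set} (P? : ∀ x → Dec (P x)) m →
            count P? (suc m) ≡ count P? m + indicator (P? m)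
count-suc P? zero    = +-comm _ 0
count-suc P? (suc m) =
  trans (cong (indicator (P? 0) +_) (count-suc (P? ∘ suc) m)) (sym (+-assoc (indicator (P? 0)) _ _))

count-yes : ∀ {P : ℕ → Set} (P? : ∀ x → Dec (P x)) {m} → P m → count P? (suc m) ≡ suc (count P? m)
count-yes P? {m} pm rewrite count-suc P? m with P? m
... | yes _   = +-comm _ 1
... | no ¬pm = contradiction pm ¬pm

count-no : ∀ {P : ℕ → Set} (P? : ∀ x → Dec (P x)) {m} → ¬ P m → count P? (suc m) ≡ count P? m
count-no P? {m} ¬pm rewrite count-suc P? m with P? m
... | yes pm = contradiction pm ¬pm
... | no _   = +-identityʳ _

count-above : ∀ q m → count (λ x → q <? suc x) m ≡ m ∸ q
count-above q zero = sym (0∸n≡0 q)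
count-above q (suc m) with q ≤? m
... | yes q≤m = begin
  count (λ x → q <? suc x) (suc m) ≡⟨ count-yes (λ x → q <? suc x) (s≤s q≤m) ⟩
  suc (count (λ x → q <? suc x) m) ≡⟨ cong suc (count-above q m) ⟩
  suc (m ∸ q)                      ≡⟨ +-∸-assoc 1 q≤m ⟨
  suc m ∸ q                        ∎
  where open ≡-Reasoning
... | no q≰m = begin
  count (λ x → q <? suc x) (suc m) ≡⟨ count-no (λ x → q <? suc x) (q≰m ∘ ≤-pred) ⟩
  count (λ x → q <? suc x) m       ≡⟨ count-above q m ⟩
  m ∸ q                            ≡⟨ m≤n⇒m∸n≡0 (<⇒≤ (≰⇒> q≰m)) ⟩
  0                                ≡⟨ m≤n⇒m∸n≡0 (≰⇒> q≰m) ⟨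
  suc m ∸ q                        ∎
  where open ≡-Reasoning

sum≡count : ∀ {P : ℕ → Set} (P? : ∀ x → Dec (P x)) m (f : Fin m → ℕ) →
            (∀ i → f i ≡ indicator (P? (toℕ i))) → sum f ≡ count P? m
sum≡count P? zero    f f≗ = refl
sum≡count P? (suc m) f f≗ = cong₂ _+_ (f≗ Fin.zero) (sum≡count (P? ∘ suc) m (f ∘ Fin.suc) (f≗ ∘ Fin.suc))

≡ᵇ-reflects-≡ : ∀ m n → Reflects (m ≡ n) (m ≡ᵇ n)
≡ᵇ-reflects-≡ m n = fromEquivalence (≡ᵇ⇒≡ m n) (≡⇒≡ᵇ m n)

swap-≢ : ∀ A {i j x} → x ≢ i → x ≢ j → swap A i j x ≡ A x
swap-≢ A {i} {j} {x} x≢i x≢j with x ≡ᵇ i | ≡ᵇ-reflects-≡ x i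
... | true  | ofʸ x≡i = contradiction x≡i x≢i
... | false | ofⁿ _ with x ≡ᵇ j | ≡ᵇ-reflects-≡ x j
...   | true  | ofʸ x≡j = contradiction x≡j x≢j
...   | false | ofⁿ _   = refl

swap-beyond : ∀ A {i j x} → j ≤ i → i < x → swap A i j x ≡ A x
swap-beyond A j≤i i<x = swap-≢ A (>⇒≢ i<x) (>⇒≢ (≤-<-trans j≤i i<x))

swap-between : ∀ A {i j x} → i < x → x < j → swap A i j x ≡ A x
swap-between A i<x x<j = swap-≢ A (>⇒≢ i<x) (<⇒≢ x<j)

delta-≤ : ∀ (A : Array) {x} → A x ≤ x → delta A x ≡ 0
delta-≤ A {x} Ax≤x with x <ᵇ A x | <ᵇ-reflects-< x (A x)
... | true  | ofʸ x<Ax = contradiction Ax≤x (<⇒≱ x<Ax)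
... | false | ofⁿ _    = refl

delta-> : ∀ (A : Array) {x} → x < A x → delta A x ≡ 1
delta-> A {x} x<Ax with x <ᵇ A x | <ᵇ-reflects-< x (A x)
... | true  | ofʸ _     = refl
... | false | ofⁿ x≮Ax = contradiction x<Ax x≮Ax

_≗[_,_]_ : Array → ℕ → ℕ → Array → Set
A ≗[ a , b ] B = ∀ x → a ≤ x → x ≤ b → A x ≡ B x

-- inner-large-count says that positions 2..n − 1 hold exactly n − q entries larger than q.
module PartitionTrace (n : ℕ) (A₀ : Array) {p q : ℕ} (p≤q : p ≤ q) (2≤n : 2 ≤ n)
  (q∉inner : ∀ x → 2 ≤ x → x < n → A₀ x ≢ q) (A₀n≤q : A₀ n ≤ q)
  (inner-large-count : count (λ x → q <? A₀ x) n + q ≡ n + count (λ x → q <? A₀ x) 2)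
  where

  C : ℕ → ℕ
  C = count (λ x → q <? A₀ x)

  -- Positions k..g, which still hold their original entries, hold exactly g + 1 − q
  -- entries larger than q. The pointers cross either just below an entry ≤ q, or
  -- after k met an entry larger than q where g stopped.
  data Balance (g k : ℕ) : Set where
    scanning : k ≤ suc g → C (suc g) + q ≡ suc g + C k → A₀ (suc g) ≤ q → Balance g k
    crossed  : k ≡ suc (suc g) → suc g ≡ q → q < A₀ (suc g) → Balance g k

  record Invariant (A : Array) (ℓ g k : ℕ) (ks gs : List ℕ) : Set where
    field
      ℓ≤k       : ℓ ≤ k
      2≤k       : 2 ≤ k
      unscanned : A ≗[ k , g ] A₀
      ks≡       : ks ≡ applyDownFrom (2 +_) (k ∸ 2)
      m         : ℕ
      gs≡       : gs ≡ applyUpTo (suc g +_) m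
      g+m≡n     : suc g + m ≡ n
      balance   : Balance g k

    g<n : g < n
    g<n = subst (suc g ≤_) g+m≡n (m≤m+n (suc g) m)

  -- Every position skipped by the inner loop holds an entry larger than q.
  record InnerExit (A : Array) (k g m g′ : ℕ) (gs′ : List ℕ) : Set where
    field
      k≤g′    : k ≤ g′
      g′≤g    : g′ ≤ g
      skipped : C (suc g) + g′ ≡ C (suc g′) + g
      m′      : ℕ
      gs′≡    : gs′ ≡ applyUpTo (g′ +_) m′
      g′+m′   : g′ + m′ ≡ suc g + m
      stop    : g′ ≡ k ⊎ (k < g′ × A g′ ≤ q)

  exit-here : ∀ {A k g gs m} → k ≤ g → gs ≡ applyUpTo (suc g +_) m →
              g ≡ k ⊎ (k < g × A g ≤ q) → InnerExit A k g m g (g ∷ gs)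
  exit-here {g = g} {m = m} k≤g gs≡ stop = record
    { k≤g′ = k≤g ; g′≤g = ≤-refl ; skipped = refl ; m′ = suc m
    ; gs′≡ = trans (cong (g ∷_) gs≡) (sym (applyUpTo-+-suc g m))
    ; g′+m′ = +-suc g m ; stop = stop }

  skip-large : ∀ {A k g m g′ gs′} → q < A₀ (suc g) → InnerExit A k g (suc m) g′ gs′ →
               InnerExit A k (suc g) m g′ gs′
  skip-large {g = g} {m} {g′} large E = record
    { k≤g′ = k≤g′ ; g′≤g = m≤n⇒m≤1+n g′≤g ; skipped = skipped′ ; m′ = m′ ; gs′≡ = gs′≡
    ; g′+m′ = trans g′+m′ (+-suc (suc g) m) ; stop = stop }
    where
    open InnerExit E
    open ≡-Reasoning
    skipped′ : C (suc (suc g)) + g′ ≡ C (suc g′) + suc g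
    skipped′ = begin
      C (suc (suc g)) + g′ ≡⟨ cong (_+ g′) (count-yes (λ x → q <? A₀ x) large) ⟩
      suc (C (suc g) + g′) ≡⟨ cong suc skipped ⟩
      suc (C (suc g′) + g) ≡⟨ +-suc (C (suc g′)) g ⟨
      C (suc g′) + suc g   ∎

  innerLoop-exit : ∀ f A {k g gs m} → 1 ≤ k → k ≤ g → g < k + f → A ≗[ k , g ] A₀ →
                   gs ≡ applyUpTo (suc g +_) m →
                   InnerExit A k g m (proj₁ (innerLoop f q A k g gs)) (proj₂ (innerLoop f q A k g gs))
  innerLoop-exit zero    A {k} {g} _ k≤g g<k+0 _ _ = contradiction k≤g (<⇒≱ (subst (g <_) (+-identityʳ k) g<k+0))
  innerLoop-exit (suc f) A {g = zero} 1≤k k≤0 _ _ _ = contradiction (≤-trans 1≤k k≤0) λ ()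
  innerLoop-exit (suc f) A {k} {suc g} 1≤k k≤g fuel agree gs≡ with q <ᵇ A (suc g) | <ᵇ-reflects-< q (A (suc g))
  ... | false | ofⁿ q≮A = exit-here k≤g gs≡ (stop (m≤n⇒m<n∨m≡n k≤g))
    where
    stop : k < suc g ⊎ k ≡ suc g → suc g ≡ k ⊎ (k < suc g × A (suc g) ≤ q)
    stop (inj₁ k<g) = inj₂ (k<g , ≮⇒≥ q≮A)
    stop (inj₂ k≡g) = inj₁ (sym k≡g)
  ... | true | ofʸ q<A with k <ᵇ suc g | <ᵇ-reflects-< k (suc g)
  ...   | false | ofⁿ k≮g = exit-here k≤g gs≡ (inj₁ (≤-antisym (≮⇒≥ k≮g) k≤g))
  ...   | true  | ofʸ k<g =
          skip-large (subst (q <_) (agree (suc g) k≤g ≤-refl) q<A)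
            (innerLoop-exit f A 1≤k (≤-pred k<g) (≤-pred (≤-trans fuel (≤-reflexive (+-suc k f))))
              (λ x k≤x x≤g → agree x k≤x (m≤n⇒m≤1+n x≤g))
              (trans (cong (suc g ∷_) gs≡) (sym (applyUpTo-+-suc (suc g) _))))

  innerExit : ∀ {A ℓ g k ks gs} (I : Invariant A ℓ g k ks gs) → k ≤ g →
              InnerExit A k g (Invariant.m I) (proj₁ (innerLoop n q A k g gs)) (proj₂ (innerLoop n q A k g gs))
  innerExit {A} {k = k} I k≤g =
    innerLoop-exit n A (≤-trans (s≤s z≤n) 2≤k) k≤g (<-≤-trans g<n (m≤n+m n k)) unscanned gs≡
    where open Invariant I

  crossed-beyond : ∀ {g k} → k ≡ suc (suc g) → ¬ k ≤ g
  crossed-beyond refl = 1+n≰n ∘ ≤-trans (n≤1+n _)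

  invariant-small : ∀ {A ℓ g k ks gs A′ ℓ′} → Invariant A ℓ g k ks gs → k ≤ g → A k < q →
                    ℓ′ ≤ suc ℓ → (∀ x → k < x → A′ x ≡ A x) →
                    Invariant A′ ℓ′ g (suc k) (k ∷ ks) gs
  invariant-small {g = g} {k} I k≤g Ak<q ℓ′≤1+ℓ frame = record
    { ℓ≤k = ≤-trans ℓ′≤1+ℓ (s≤s ℓ≤k) ; 2≤k = m≤n⇒m≤1+n 2≤k
    ; unscanned = λ x k<x x≤g → trans (frame x k<x) (unscanned x (<⇒≤ k<x) x≤g)
    ; ks≡ = trans (cong (k ∷_) ks≡) (sym (applyDownFrom-+-∸-suc 2≤k))
    ; m = m ; gs≡ = gs≡ ; g+m≡n = g+m≡n ; balance = balance′ balance }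
    where
    open Invariant I
    small : ¬ q < A₀ k
    small = <⇒≱ (subst (_< q) (unscanned k ≤-refl k≤g) Ak<q) ∘ <⇒≤
    balance′ : Balance g k → Balance g (suc k)
    balance′ (scanning _ bal last) =
      scanning (s≤s k≤g) (trans bal (cong (suc g +_) (sym (count-no (λ x → q <? A₀ x) small)))) last
    balance′ (crossed k≡2+g _ _) = contradiction k≤g (crossed-beyond k≡2+g)

  invariant-large : ∀ {A ℓ g k ks gs g′ gs′ A′ ℓ′} (I : Invariant A ℓ g k ks gs) → k ≤ g → q ≤ A k →
                    InnerExit A k g (Invariant.m I) g′ gs′ → ℓ′ ≤ suc ℓ → (∀ x → k < x → x < g′ → A′ x ≡ A x) →
                    Invariant A′ ℓ′ (g′ ∸ 1) (suc k) (k ∷ ks) gs′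
  invariant-large {g′ = zero} I _ _ E _ _ =
    contradiction (≤-trans (Invariant.2≤k I) (InnerExit.k≤g′ E)) λ ()
  invariant-large {A} {g = g} {k} {g′ = suc g₁} I k≤g q≤Ak E ℓ′≤1+ℓ frame = record
    { ℓ≤k = ≤-trans ℓ′≤1+ℓ (s≤s ℓ≤k) ; 2≤k = m≤n⇒m≤1+n 2≤k
    ; unscanned = λ x k<x x≤g₁ →
        trans (frame x k<x (s≤s x≤g₁)) (unscanned x (<⇒≤ k<x) (≤-trans (m≤n⇒m≤1+n x≤g₁) g′≤g))
    ; ks≡ = trans (cong (k ∷_) ks≡) (sym (applyDownFrom-+-∸-suc 2≤k))
    ; m = m′ ; gs≡ = gs′≡ ; g+m≡n = trans g′+m′ g+m≡n ; balance = balance′ stop balance }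
    where
    open Invariant I
    open InnerExit E
    open ≡-Reasoning
    large : q < A₀ k
    large = ≤∧≢⇒< (subst (q ≤_) (unscanned k ≤-refl k≤g) q≤Ak)
                  (q∉inner k 2≤k (≤-<-trans k≤g g<n) ∘ sym)
    C[1+k] : C (suc k) ≡ suc (C k)
    C[1+k] = count-yes (λ x → q <? A₀ x) large
    balance′ : suc g₁ ≡ k ⊎ (k < suc g₁ × A (suc g₁) ≤ q) → Balance g k → Balance g₁ (suc k)
    balance′ _ (crossed k≡2+g _ _) = contradiction k≤g (crossed-beyond k≡2+g)
    balance′ (inj₁ refl) (scanning _ bal _) = crossed refl (sym q≡g′) large
      where
      q≡g′ : q ≡ suc g₁
      q≡g′ = +-cancelˡ-≡ (C (suc g)) q (suc g₁) (begin
        C (suc g) + q        ≡⟨ bal ⟩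
        suc g + C k          ≡⟨ cong suc (+-comm g (C k)) ⟩
        suc (C k) + g        ≡⟨ cong (_+ g) C[1+k] ⟨
        C (suc (suc g₁)) + g ≡⟨ skipped ⟨
        C (suc g) + suc g₁   ∎)
    balance′ (inj₂ (k<g′ , Ag′≤q)) (scanning _ bal _) = scanning k<g′ bal′ small
      where
      small : A₀ (suc g₁) ≤ q
      small = subst (_≤ q) (unscanned (suc g₁) k≤g′ g′≤g) Ag′≤q
      bal′ : C (suc g₁) + q ≡ suc g₁ + C (suc k)
      bal′ = +-cancelʳ-≡ g _ _ (begin
        (C (suc g₁) + q) + g        ≡⟨ xy∙z≈xz∙y (C (suc g₁)) q g ⟩
        (C (suc g₁) + g) + q        ≡⟨ cong (λ c → (c + g) + q) (count-no (λ x → q <? A₀ x) (≤⇒≯ small)) ⟨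
        (C (suc (suc g₁)) + g) + q  ≡⟨ cong (_+ q) skipped ⟨
        (C (suc g) + suc g₁) + q    ≡⟨ xy∙z≈xz∙y (C (suc g)) (suc g₁) q ⟩
        (C (suc g) + q) + suc g₁    ≡⟨ cong (_+ suc g₁) bal ⟩
        (suc g + C k) + suc g₁      ≡⟨ rearrange g (C k) (suc g₁) ⟩
        (suc g₁ + suc (C k)) + g    ≡⟨ cong (λ c → (suc g₁ + c) + g) C[1+k] ⟨
        (suc g₁ + C (suc k)) + g    ∎)
        where
        rearrange : ∀ g c g′ → (suc g + c) + g′ ≡ (g′ + suc c) + g
        rearrange = solve-∀

  balance-at-exit : ∀ {g k} → Balance g k → g < k → suc g ≡ q × k ≡ q + delta A₀ q
  balance-at-exit {g} (scanning k≤1+g bal last) g<k with ≤-antisym k≤1+g g<k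
  ... | refl = sym q≡1+g , (begin
    suc g          ≡⟨ q≡1+g ⟨
    q              ≡⟨ +-identityʳ q ⟨
    q + 0          ≡⟨ cong (q +_) (delta-≤ A₀ (subst (λ x → A₀ x ≤ q) (sym q≡1+g) last)) ⟨
    q + delta A₀ q ∎)
    where
    open ≡-Reasoning
    q≡1+g : q ≡ suc g
    q≡1+g = +-cancelˡ-≡ (C (suc g)) q (suc g) (trans bal (+-comm (suc g) (C (suc g))))
  balance-at-exit {g} (crossed refl refl large) _ =
    refl , sym (trans (cong (suc g +_) (delta-> A₀ large)) (+-comm (suc g) 1))

  Trace : State → Set
  Trace s = State.ks s ≡ applyDownFrom (2 +_) (q + delta A₀ q ∸ 2) × State.gs s ≡ applyUpTo (q +_) (n ∸ q)

  trace-at-exit : ∀ {A ℓ g k ks gs} → Invariant A ℓ g k ks gs → g < k → Trace (st A ℓ g k ks gs)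
  trace-at-exit I g<k with balance-at-exit (Invariant.balance I) g<k
  ... | 1+g≡q , k≡q+δ =
    trans ks≡ (cong (λ k → applyDownFrom (2 +_) (k ∸ 2)) k≡q+δ) ,
    trans gs≡ (cong₂ (λ a m → applyUpTo (a +_) m) 1+g≡q m≡n∸q)
    where
    open Invariant I
    m≡n∸q : m ≡ n ∸ q
    m≡n∸q = trans (sym (m+n∸m≡n q m)) (cong (_∸ q) (trans (cong (_+ m) (sym 1+g≡q)) g+m≡n))

  fuel-step : ∀ {g g′ k f} → suc g < k + suc f → g′ ≤ g → suc g′ < suc k + f
  fuel-step {k = k} {f} fuel g′≤g = ≤-<-trans (s≤s g′≤g) (≤-trans fuel (≤-reflexive (+-suc k f)))

  outerLoop-trace : ∀ f {A ℓ g k ks gs} → Invariant A ℓ g k ks gs → suc g < k + f →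
                    Trace (outerLoop f n p q (st A ℓ g k ks gs))
  outerLoop-trace zero {g = g} {k} I fuel =
    trace-at-exit I (<-trans (n<1+n g) (subst (suc g <_) (+-identityʳ k) fuel))
  outerLoop-trace (suc f) {A} {ℓ} {g} {k} {ks} {gs} I fuel with k ≤ᵇ g | ≤ᵇ-reflects-≤ k g
  ... | false | ofⁿ k≰g = trace-at-exit I (≰⇒> k≰g)
  ... | true  | ofʸ k≤g with A k <ᵇ p | <ᵇ-reflects-< (A k) p
  ...   | true | ofʸ Ak<p =
          outerLoop-trace f
            (invariant-small I k≤g (<-≤-trans Ak<p p≤q) ≤-refl (λ _ → swap-beyond A (Invariant.ℓ≤k I)))
            (fuel-step fuel ≤-refl)
  ...   | false | ofⁿ _ with q ≤ᵇ A k | ≤ᵇ-reflects-≤ q (A k)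
  ...     | false | ofⁿ q≰Ak =
            outerLoop-trace f
              (invariant-small I k≤g (≰⇒> q≰Ak) (n≤1+n ℓ) (λ _ _ → refl))
              (fuel-step fuel ≤-refl)
  ...     | true  | ofʸ q≤Ak
          with innerLoop n q A k g gs | innerExit I k≤g
  ...       | g′ , gs′ | E with p ≤ᵇ A g′
  ...         | true =
                outerLoop-trace f
                  (invariant-large I k≤g q≤Ak E (n≤1+n ℓ) (λ _ → swap-between A))
                  (fuel-step fuel (≤-trans (m∸n≤m g′ 1) (InnerExit.g′≤g E)))
  ...         | false =
                outerLoop-trace f
                  (invariant-large I k≤g q≤Ak E ≤-refl
                     (λ _ k<x x<g′ → trans (swap-beyond (swap A k g′) (Invariant.ℓ≤k I) k<x) (swap-between A k<x x<g′)))
                  (fuel-step fuel (≤-trans (m∸n≤m g′ 1) (InnerExit.g′≤g E)))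

  partitionRun-trace : Trace (outerLoop n n p q (st A₀ 2 (n ∸ 1) 2 [] []))
  partitionRun-trace = outerLoop-trace n initial (subst (_< 2 + n) (sym 1+[n∸1]≡n) (m<n⇒m<1+n (n<1+n n)))
    where
    1+[n∸1]≡n : suc (n ∸ 1) ≡ n
    1+[n∸1]≡n = m+[n∸m]≡n (≤-trans (n≤1+n 1) 2≤n)
    initial : Invariant A₀ 2 (n ∸ 1) 2 [] []
    initial = record
      { ℓ≤k = ≤-refl ; 2≤k = ≤-refl ; unscanned = λ _ _ _ → refl ; ks≡ = refl ; m = 0 ; gs≡ = refl
      ; g+m≡n = trans (+-identityʳ _) 1+[n∸1]≡n
      ; balance = scanning (subst (2 ≤_) (sym 1+[n∸1]≡n) 2≤n)
                           (subst (λ N → C N + q ≡ N + C 2) (sym 1+[n∸1]≡n) inner-large-count)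
                           (subst (λ N → A₀ N ≤ q) (sym 1+[n∸1]≡n) A₀n≤q) }

arrayOf-suc : ∀ {n} (σ : Permutation′ n) {i} (i<n : i < n) →
              arrayOf n σ (suc i) ≡ suc (toℕ (σ ⟨$⟩ʳ fromℕ< i<n))
arrayOf-suc {n} σ {i} i<n with i <? n
... | yes _  = refl
... | no i≮n = contradiction i<n i≮n

arrayOf-positive : ∀ {n} (σ : Permutation′ n) {i} → i < n → 1 ≤ arrayOf n σ (suc i)
arrayOf-positive σ i<n rewrite arrayOf-suc σ i<n = s≤s z≤n

arrayOf-≤ : ∀ {n} (σ : Permutation′ n) {i} → i < n → arrayOf n σ (suc i) ≤ n
arrayOf-≤ σ i<n rewrite arrayOf-suc σ i<n = toℕ<n (σ ⟨$⟩ʳ fromℕ< i<n)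

arrayOf-injective : ∀ {n} (σ : Permutation′ n) {i j} (i<n : i < n) (j<n : j < n) →
                    arrayOf n σ (suc i) ≡ arrayOf n σ (suc j) → i ≡ j
arrayOf-injective σ {i} {j} i<n j<n A[i]≡A[j] = begin
  i                 ≡⟨ toℕ-fromℕ< i<n ⟨
  toℕ (fromℕ< i<n)  ≡⟨ cong toℕ (trans (sym (inverseˡ σ)) (trans (cong (σ ⟨$⟩ˡ_) σi≡σj) (inverseˡ σ))) ⟩
  toℕ (fromℕ< j<n)  ≡⟨ toℕ-fromℕ< j<n ⟩
  j                 ∎
  where
  open ≡-Reasoning
  σi≡σj : σ ⟨$⟩ʳ fromℕ< i<n ≡ σ ⟨$⟩ʳ fromℕ< j<n
  σi≡σj = toℕ-injective (suc-injective (trans (sym (arrayOf-suc σ i<n)) (trans A[i]≡A[j] (arrayOf-suc σ j<n))))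

-- Position 0 holds the junk value 0, so only the values at positions 1..n are counted.
count-arrayOf-> : ∀ {n} (σ : Permutation′ n) q → count (λ x → q <? arrayOf n σ x) (suc n) ≡ n ∸ q
count-arrayOf-> {n} σ q = begin
  count (λ x → q <? arrayOf n σ x) (suc n)     ≡⟨ sum≡count (λ x → q <? arrayOf n σ (suc x)) n (f ∘ (σ ⟨$⟩ʳ_)) f∘σ≗ ⟨
  sum (f ∘ (σ ⟨$⟩ʳ_))                           ≡⟨ sum-permute f σ ⟨
  sum f                                         ≡⟨ sum≡count (λ x → q <? suc x) n f (λ _ → refl) ⟩
  count (λ x → q <? suc x) n                    ≡⟨ count-above q n ⟩
  n ∸ q                                         ∎
  where
  open ≡-Reasoning
  f : Fin n → ℕ
  f j = indicator (q <? suc (toℕ j))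
  f∘σ≗ : ∀ i → f (σ ⟨$⟩ʳ i) ≡ indicator (q <? arrayOf n σ (suc (toℕ i)))
  f∘σ≗ i = cong (λ a → indicator (q <? a))
             (sym (trans (arrayOf-suc σ (toℕ<n i)) (cong (λ j → suc (toℕ (σ ⟨$⟩ʳ j))) (fromℕ<-toℕ i (toℕ<n i)))))

2≤⊔ : ∀ {a b} → a ≢ b → 1 ≤ a → 1 ≤ b → 2 ≤ a ⊔ b
2≤⊔ {suc zero}    {suc zero}    a≢b _ _ = contradiction refl a≢b
2≤⊔ {suc zero}    {suc (suc b)} _   _ _ = s≤s (s≤s z≤n)
2≤⊔ {suc (suc a)} {b}           _   _ _ = ≤-trans (s≤s (s≤s z≤n)) (m≤m⊔n (suc (suc a)) b)

module Endpoints {n} (1≤n : 1 ≤ n) (σ : Permutation′ (suc n)) where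

  A : Array
  A = arrayOf (suc n) σ

  q : ℕ
  q = A 1 ⊔ A (suc n)

  2≤q : 2 ≤ q
  2≤q = 2≤⊔ (0≢n ∘ arrayOf-injective σ z<s (n<1+n n)) (arrayOf-positive σ z<s) (arrayOf-positive σ (n<1+n n))
    where
    0≢n : 0 ≢ n
    0≢n refl = contradiction 1≤n λ ()

  q≤1+n : q ≤ suc n
  q≤1+n = ⊔-lub (arrayOf-≤ σ z<s) (arrayOf-≤ σ (n<1+n n))

  A[1+n]≤q : A (suc n) ≤ q
  A[1+n]≤q = m≤n⊔m (A 1) (A (suc n))

  q∉inner : ∀ x → 2 ≤ x → x < suc n → A x ≢ q
  q∉inner (suc i) (s≤s 1≤i) (s≤s i<n) A[1+i]≡q with ⊔-sel (A 1) (A (suc n))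
  ... | inj₁ q≡A[1]   = contradiction (arrayOf-injective σ (m<n⇒m<1+n i<n) z<s (trans A[1+i]≡q q≡A[1])) (>⇒≢ 1≤i)
  ... | inj₂ q≡A[1+n] = contradiction (arrayOf-injective σ (m<n⇒m<1+n i<n) (n<1+n n) (trans A[1+i]≡q q≡A[1+n])) (<⇒≢ i<n)

  inner-large-count : count (λ x → q <? A x) (suc n) + q ≡ suc n + count (λ x → q <? A x) 2
  inner-large-count = begin
    count (λ x → q <? A x) (suc n) + q       ≡⟨ cong (_+ q) (count-no (λ x → q <? A x) (≤⇒≯ A[1+n]≤q)) ⟨
    count (λ x → q <? A x) (suc (suc n)) + q ≡⟨ cong (_+ q) (count-arrayOf-> σ q) ⟩
    suc n ∸ q + q                            ≡⟨ m∸n+n≡m q≤1+n ⟩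
    suc n                                    ≡⟨ +-identityʳ (suc n) ⟨
    suc n + 0                                ≡⟨ cong (suc n +_) count-below-2 ⟨
    suc n + count (λ x → q <? A x) 2         ∎
    where
    open ≡-Reasoning
    count-below-2 : count (λ x → q <? A x) 2 ≡ 0
    count-below-2 = trans (count-no (λ x → q <? A x) {1} (≤⇒≯ (m≤m⊔n (A 1) (A (suc n)))))
                          (count-no (λ x → q <? A x) {0} λ ())

corollary3p6 : (n : ℕ) → 2 ≤ n → (σ : Permutation′ n) →
    ((∀ x → (x ∈ Kvals n (arrayOf n σ)) ⇔ (2 ≤ x × x ≤ (arrayOf n σ 1 ⊔ arrayOf n σ n) ∸ 1 + delta (arrayOf n σ) (arrayOf n σ 1 ⊔ arrayOf n σ n)))
     × length (deduplicate _≟_ (Kvals n (arrayOf n σ))) ≡ (arrayOf n σ 1 ⊔ arrayOf n σ n) ∸ 2 + delta (arrayOf n σ) (arrayOf n σ 1 ⊔ arrayOf n σ n))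
    × ((∀ x → (x ∈ Gvals n (arrayOf n σ)) ⇔ ((arrayOf n σ 1 ⊔ arrayOf n σ n) ≤ x × x ≤ n ∸ 1))
     × length (deduplicate _≟_ (Gvals n (arrayOf n σ))) ≡ n ∸ (arrayOf n σ 1 ⊔ arrayOf n σ n))
corollary3p6 (suc n) 2≤n@(s≤s 1≤n) σ = (∈K , |K|) , (∈G , |G|)
  where
  open Endpoints 1≤n σ
  open PartitionTrace (suc n) A (m⊓n≤m⊔n (A 1) (A (suc n))) 2≤n q∉inner A[1+n]≤q inner-large-count
  δ : ℕ
  δ = delta A q
  K≡ : Kvals (suc n) A ≡ applyDownFrom (2 +_) (q + δ ∸ 2)
  K≡ = proj₁ partitionRun-trace
  G≡ : Gvals (suc n) A ≡ applyUpTo (q +_) (suc n ∸ q)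
  G≡ = proj₂ partitionRun-trace
  ∈K : ∀ x → x ∈ Kvals (suc n) A ⇔ (2 ≤ x × x ≤ q ∸ 1 + δ)
  ∈K x rewrite K≡ = ∈-applyDownFrom-+ (begin
    2 + (q + δ ∸ 2)   ≡⟨ m+[n∸m]≡n (≤-trans 2≤q (m≤m+n q δ)) ⟩
    q + δ             ≡⟨ cong (_+ δ) (m+[n∸m]≡n (≤-trans (n≤1+n 1) 2≤q)) ⟨
    suc (q ∸ 1 + δ)   ∎)
    where open ≡-Reasoning
  |K| : length (deduplicate _≟_ (Kvals (suc n) A)) ≡ q ∸ 2 + δ
  |K| rewrite K≡ | deduplicate-applyDownFrom-+ 2 (q + δ ∸ 2) =
    trans (length-applyDownFrom (2 +_) (q + δ ∸ 2)) (+-∸-comm δ 2≤q)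
  ∈G : ∀ x → x ∈ Gvals (suc n) A ⇔ (q ≤ x × x ≤ n)
  ∈G x rewrite G≡ = ∈-applyUpTo-+ (m+[n∸m]≡n q≤1+n)
  |G| : length (deduplicate _≟_ (Gvals (suc n) A)) ≡ suc n ∸ q
  |G| rewrite G≡ | deduplicate-applyUpTo-+ q (suc n ∸ q) = length-applyUpTo (q +_) (suc n ∸ q)
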